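{- Let $\mathbf D\subseteq\mathbf T$ be a normal super-domain, i.e. $\emptyset\in\mathbf D$ and $\Lambda\in\mathbf D$. Then the following are equivalent: (i) the tilings in $\mathbf D$ are pairwise compatible; (ii) $\mathbf D$ is a Condorcet super-domain.
   Context: Fix an integer $n\ge 2$, $[n]=\{1,\dots,n\}$, and let $\Lambda$ be the set of triples $ijk$ with $i<j<k$ in $[n]$. For a quadruple $i<j<k<l$, its stick is the ordered sequence $(ijk,ijl,ikl,jkl)$. A subset of $\Lambda$ is a pseudo-tiling; it is a tiling if for every quadruple $i<j<k<l$ its intersection with the stick, written as a 0/1 string along the stick order, is one of $0000,1000,1100,1110,1111,0111,0011,0001$ (these are the inversion sets of rhombus tilings of the zonogon $Z(n;2)$; $\emptyset$ is the standard and $\Lambda$ the anti-standard tiling). $\mathbf T$ denotes the set of tilings; a super-domain is a subset of $\mathbf T$. Two tilings $T,T'$ are compatible if both $T\cap T'$ and $T\cup T'$ are tilings. Majority rule: for a finite set $V$ of odd cardinality and a family $(T_v)_{v\in V}$ of tilings (repetitions allowed), $sm((T_v)_{v\in V})=\{ijk\in\Lambda: |\{v: ijk\in T_v\}|>|V|/2\}$. A super-domain $\mathbf D$ is a Condorcet super-domain if for every finite odd-cardinality $V$ and every family $(T_v)_{v\in V}$ with all $T_v\in\mathbf D$, $sm((T_v)_{v\in V})$ is a tiling. -}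

module Defs where

open import Data.Nat using (ℕ; zero; suc; _+_; _*_; _<_; _≤_)
open import Data.Nat.Properties using (<-trans)
open import Data.Fin using (Fin; toℕ) renaming (zero to fzero; suc to fsuc)
open import Data.Bool using (Bool; true; false; _∧_; _∨_; if_then_else_)
open import Data.Product using (Σ; ∃; _×_; _,_)
open import Relation.Binary.PropositionalEquality using (_≡_)

_≺_ : ∀ {n} → Fin n → Fin n → Set
i ≺ j = toℕ i < toℕ j

-- An element ijk of Λ : a triple i < j < k in [n].
record Triple (n : ℕ) : Set where
  constructor triple
  field
    i j k : Fin n
    i<j : i ≺ j
    j<k : j ≺ k

PseudoTiling : ℕ → Set
PseudoTiling n = Triple n → Bool

∅T : ∀ {n} → PseudoTiling n
∅T _ = false

ΛT : ∀ {n} → PseudoTiling n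
ΛT _ = true

_∩T_ : ∀ {n} → PseudoTiling n → PseudoTiling n → PseudoTiling n
(T ∩T T') t = T t ∧ T' t

_∪T_ : ∀ {n} → PseudoTiling n → PseudoTiling n → PseudoTiling n
(T ∪T T') t = T t ∨ T' t

data AllowedStick : Bool → Bool → Bool → Bool → Set where
  s0000 : AllowedStick false false false false
  s1000 : AllowedStick true  false false false
  s1100 : AllowedStick true  true  false false
  s1110 : AllowedStick true  true  true  false
  s1111 : AllowedStick true  true  true  true
  s0111 : AllowedStick false true  true  true
  s0011 : AllowedStick false false true  true
  s0001 : AllowedStick false false false true

IsTiling : ∀ {n} → PseudoTiling n → Set
IsTiling {n} T =
  (i j k l : Fin n) (i<j : i ≺ j) (j<k : j ≺ k) (k<l : k ≺ l) →
  AllowedStick (T (triple i j k i<j j<k))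
               (T (triple i j l i<j (<-trans j<k k<l)))
               (T (triple i k l (<-trans i<j j<k) k<l))
               (T (triple j k l j<k k<l))

SuperDomain : ℕ → Set₁
SuperDomain n = PseudoTiling n → Set

IsSuperDomain : ∀ {n} → SuperDomain n → Set
IsSuperDomain {n} D = (T : PseudoTiling n) → D T → IsTiling T

IsNormal : ∀ {n} → SuperDomain n → Set
IsNormal D = D ∅T × D ΛT

Compatible : ∀ {n} → PseudoTiling n → PseudoTiling n → Set
Compatible T T' = IsTiling (T ∩T T') × IsTiling (T ∪T T')

PairwiseCompatible : ∀ {n} → SuperDomain n → Set
PairwiseCompatible {n} D =
  (T T' : PseudoTiling n) → D T → D T' → Compatible T T'

countTrue : ∀ m → (Fin m → Bool) → ℕ
countTrue zero    f = 0
countTrue (suc m) f = (if f fzero then 1 else 0) + countTrue m (λ v → f (fsuc v))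

Odd : ℕ → Set
Odd m = ∃ λ r → m ≡ suc (2 * r)

-- Strict-majority rule for a family (T_v)_{v ∈ Fin m}:
-- ijk ∈ sm iff |{v : ijk ∈ T_v}| > m/2, i.e. 2·count > m.
_<ᵇ_ : ℕ → ℕ → Bool
zero  <ᵇ zero  = false
zero  <ᵇ suc _ = true
suc _ <ᵇ zero  = false
suc a <ᵇ suc b = a <ᵇ b

sm : ∀ {n m} → (Fin m → PseudoTiling n) → PseudoTiling n
sm {n} {m} Ts t = m <ᵇ (2 * countTrue m (λ v → Ts v t))

-- Condorcet super-domain: the majority of every odd-size family from D
-- is a tiling.  (A finite index set V of odd cardinality is taken as Fin m.)
IsCondorcet : ∀ {n} → SuperDomain n → Set
IsCondorcet {n} D =
  (m : ℕ) → Odd m → (Ts : Fin m → PseudoTiling n) →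
  ((v : Fin m) → D (Ts v)) → IsTiling (sm Ts)

-- Along a single stick, a tiling is a 0/1 string that is either non-increasing
-- (1ᵏ0⁴⁻ᵏ) or non-decreasing (0ᵏ1⁴⁻ᵏ), and majority voting preserves every
-- inequality or equality between two positions that holds for all voters.
-- If all voters' strings are non-increasing, or all non-decreasing, the
-- majority string is too. Otherwise some voter u is 1ᵏ0⁴⁻ᵏ and another 0ᵏ'1⁴⁻ᵏ'
-- with 0 < k, k' < 4; compatibility forces the second to be the complement of
-- u, and every voter compatible with both is constant on the two blocks of u,
-- a property that again survives majority. Conversely, the majority of T, T'
-- and ∅ (resp. Λ) is T ∩ T' (resp. T ∪ T').
module Submission where

open import Defs
open import Data.Nat using (ℕ; zero; suc; _+_; _≤_; _*_; z≤n; s≤s)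
open import Data.Nat.Properties using (≤-refl; +-mono-≤; *-monoʳ-≤; <-trans)
open import Data.Fin using (Fin) renaming (zero to fzero; suc to fsuc)
open import Data.Fin.Properties using (all?; ¬∀⟶∃¬)
open import Data.Bool as B using (Bool; true; false; _∧_; _∨_; not; if_then_else_; b≤b; f≤t)
open import Data.Bool.Properties using (_≤?_; ≤-minimum)
open import Data.Vec.Functional using (_∷_; [])
open import Data.Product using (_×_; _,_; proj₁; proj₂; ∃)
open import Data.Sum using (_⊎_; inj₁; inj₂)
open import Function using (_∘_)
open import Relation.Nullary using (¬_; yes; no; contradiction)
open import Relation.Binary.PropositionalEquality using (_≡_; refl; sym; cong; cong₂; trans; subst)

maj : ∀ {m} → (Fin m → Bool) → Bool
maj {m} f = m <ᵇ (2 * countTrue m f)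

<ᵇ-monoʳ : ∀ a {b c} → b ≤ c → (a <ᵇ b) B.≤ (a <ᵇ c)
<ᵇ-monoʳ zero    {zero}  _         = ≤-minimum _
<ᵇ-monoʳ zero    {suc _} (s≤s _)   = b≤b
<ᵇ-monoʳ (suc a) {zero}  _         = ≤-minimum _
<ᵇ-monoʳ (suc a) {suc _} (s≤s b≤c) = <ᵇ-monoʳ a b≤c

countTrue-mono : ∀ m {f g : Fin m → Bool} → (∀ v → f v B.≤ g v) → countTrue m f ≤ countTrue m g
countTrue-mono zero    f≤g = z≤n
countTrue-mono (suc m) f≤g = +-mono-≤ (indicator-mono (f≤g fzero)) (countTrue-mono m (f≤g ∘ fsuc))
  where
  indicator-mono : ∀ {x y} → x B.≤ y → (if x then 1 else 0) ≤ (if y then 1 else 0)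
  indicator-mono b≤b = ≤-refl
  indicator-mono f≤t = z≤n

maj-mono : ∀ {m} {f g : Fin m → Bool} → (∀ v → f v B.≤ g v) → maj f B.≤ maj g
maj-mono {m} f≤g = <ᵇ-monoʳ m (*-monoʳ-≤ 2 (countTrue-mono m f≤g))

countTrue-cong : ∀ m {f g : Fin m → Bool} → (∀ v → f v ≡ g v) → countTrue m f ≡ countTrue m g
countTrue-cong zero    f≗g = refl
countTrue-cong (suc m) f≗g =
  cong₂ _+_ (cong (λ x → if x then 1 else 0) (f≗g fzero)) (countTrue-cong m (f≗g ∘ fsuc))

maj-cong : ∀ {m} {f g : Fin m → Bool} → (∀ v → f v ≡ g v) → maj f ≡ maj g
maj-cong {m} f≗g = cong (λ k → m <ᵇ (2 * k)) (countTrue-cong m f≗g)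

maj-if : ∀ {m} x (f g : Fin m → Bool) →
  maj (λ v → if x then f v else g v) ≡ (if x then maj f else maj g)
maj-if true  f g = refl
maj-if false f g = refl

maj-∧ : ∀ x y → maj (x ∷ y ∷ false ∷ []) ≡ x ∧ y
maj-∧ true  true  = refl
maj-∧ true  false = refl
maj-∧ false true  = refl
maj-∧ false false = refl

maj-∨ : ∀ x y → maj (x ∷ y ∷ true ∷ []) ≡ x ∨ y
maj-∨ true  true  = refl
maj-∨ true  false = refl
maj-∨ false true  = refl
maj-∨ false false = refl

record Stick : Set where
  constructor stick
  field
    x₁ x₂ x₃ x₄ : Bool

open Stick

Allowed : Stick → Set
Allowed s = AllowedStick (x₁ s) (x₂ s) (x₃ s) (x₄ s)

_∧ˢ_ _∨ˢ_ : Stick → Stick → Stick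
s ∧ˢ s' = stick (x₁ s ∧ x₁ s') (x₂ s ∧ x₂ s') (x₃ s ∧ x₃ s') (x₄ s ∧ x₄ s')
s ∨ˢ s' = stick (x₁ s ∨ x₁ s') (x₂ s ∨ x₂ s') (x₃ s ∨ x₃ s') (x₄ s ∨ x₄ s')

complement : Stick → Stick
complement s = stick (not (x₁ s)) (not (x₂ s)) (not (x₃ s)) (not (x₄ s))

reverse : Stick → Stick
reverse s = stick (x₄ s) (x₃ s) (x₂ s) (x₁ s)

CompatibleSticks : Stick → Stick → Set
CompatibleSticks s s' = Allowed (s ∧ˢ s') × Allowed (s ∨ˢ s')

majˢ : ∀ {m} → (Fin m → Stick) → Stick
majˢ s = stick (maj (x₁ ∘ s)) (maj (x₂ ∘ s)) (maj (x₃ ∘ s)) (maj (x₄ ∘ s))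

-- IsTiling T unfolds to Allowed (stickAt T i j k l …) at every quadruple, and
-- stickAt (sm Ts) … to majˢ of the voters' sticks; both hold definitionally.
stickAt : ∀ {n} → PseudoTiling n → (i j k l : Fin n) → i ≺ j → j ≺ k → k ≺ l → Stick
stickAt T i j k l i<j j<k k<l =
  stick (T (triple i j k i<j j<k)) (T (triple i j l i<j (<-trans j<k k<l)))
        (T (triple i k l (<-trans i<j j<k) k<l)) (T (triple j k l j<k k<l))

stick-cong : ∀ {a b c d a' b' c' d'} →
  a ≡ a' → b ≡ b' → c ≡ c' → d ≡ d' → stick a b c d ≡ stick a' b' c' d'
stick-cong refl refl refl refl = refl

IsTiling-resp : ∀ {n} {S S' : PseudoTiling n} → (∀ t → S t ≡ S' t) → IsTiling S → IsTiling S'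
IsTiling-resp S≗S' tiling i j k l i<j j<k k<l =
  subst Allowed (stick-cong (S≗S' _) (S≗S' _) (S≗S' _) (S≗S' _)) (tiling i j k l i<j j<k k<l)

allowed-reverse : ∀ {s} → Allowed s → Allowed (reverse s)
allowed-reverse s0000 = s0000
allowed-reverse s1000 = s0001
allowed-reverse s1100 = s0011
allowed-reverse s1110 = s0111
allowed-reverse s1111 = s1111
allowed-reverse s0111 = s1110
allowed-reverse s0011 = s1100
allowed-reverse s0001 = s1000

Descending : Stick → Set
Descending s = x₄ s B.≤ x₃ s × x₃ s B.≤ x₂ s × x₂ s B.≤ x₁ s

Ascending : Stick → Set
Ascending = Descending ∘ reverse

descending⇒allowed : ∀ {s} → Descending s → Allowed s
descending⇒allowed {stick false false false false} _ = s0000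
descending⇒allowed {stick true  false false false} _ = s1000
descending⇒allowed {stick true  true  false false} _ = s1100
descending⇒allowed {stick true  true  true  false} _ = s1110
descending⇒allowed {stick true  true  true  true } _ = s1111
descending⇒allowed {stick _ _ false true} (() , _ , _)
descending⇒allowed {stick _ false true _} (_ , () , _)
descending⇒allowed {stick false true _ _} (_ , _ , ())

allowed⇒descending : ∀ {s} → Allowed s → x₄ s B.≤ x₁ s → Descending s
allowed⇒descending s0000 _ = b≤b , b≤b , b≤b
allowed⇒descending s1000 _ = b≤b , b≤b , f≤t
allowed⇒descending s1100 _ = b≤b , f≤t , b≤b
allowed⇒descending s1110 _ = f≤t , b≤b , b≤b
allowed⇒descending s1111 _ = b≤b , b≤b , b≤b
allowed⇒descending s0111 ()
allowed⇒descending s0011 ()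
allowed⇒descending s0001 ()

allowed⇒ascending : ∀ {s} → Allowed s → x₁ s B.≤ x₄ s → Ascending s
allowed⇒ascending = allowed⇒descending ∘ allowed-reverse

ascending⇒allowed : ∀ {s} → Ascending s → Allowed s
ascending⇒allowed = allowed-reverse ∘ descending⇒allowed

majˢ-descending : ∀ {m} {s : Fin m → Stick} → (∀ v → Descending (s v)) → Descending (majˢ s)
majˢ-descending desc =
  maj-mono (proj₁ ∘ desc) , maj-mono (proj₁ ∘ proj₂ ∘ desc) , maj-mono (proj₂ ∘ proj₂ ∘ desc)

majˢ-ascending : ∀ {m} {s : Fin m → Stick} → (∀ v → Ascending (s v)) → Ascending (majˢ s)
majˢ-ascending = majˢ-descending

Falling : Stick → Set
Falling s = x₁ s ≡ true × x₄ s ≡ false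

Rising : Stick → Set
Rising = Falling ∘ reverse

≰⇒falling : ∀ {s} → ¬ (x₁ s B.≤ x₄ s) → Falling s
≰⇒falling {stick false _ _ x₄} x₁≰x₄ = contradiction (≤-minimum x₄) x₁≰x₄
≰⇒falling {stick true _ _ true} x₁≰x₄ = contradiction b≤b x₁≰x₄
≰⇒falling {stick true _ _ false} _ = refl , refl

≰⇒rising : ∀ {s} → ¬ (x₄ s B.≤ x₁ s) → Rising s
≰⇒rising {s} = ≰⇒falling {reverse s}

blocks : Stick → Bool → Bool → Stick
blocks u p q = stick p (if x₂ u then p else q) (if x₃ u then p else q) q

falling-compatible-rising : ∀ {u w} → Allowed u → Falling u → Allowed w → Rising w →
  CompatibleSticks u w → w ≡ complement u
falling-compatible-rising s1000 _ s0111 _ _ = refl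
falling-compatible-rising s1100 _ s0011 _ _ = refl
falling-compatible-rising s1110 _ s0001 _ _ = refl
falling-compatible-rising s1000 _ s0011 _ (_ , ())
falling-compatible-rising s1000 _ s0001 _ (_ , ())
falling-compatible-rising s1100 _ s0111 _ (() , _)
falling-compatible-rising s1100 _ s0001 _ (_ , ())
falling-compatible-rising s1110 _ s0111 _ (() , _)
falling-compatible-rising s1110 _ s0011 _ (() , _)
falling-compatible-rising s0000 (() , _) _ _ _
falling-compatible-rising s1111 (_ , ()) _ _ _
falling-compatible-rising s0111 (() , _) _ _ _
falling-compatible-rising s0011 (() , _) _ _ _
falling-compatible-rising s0001 (() , _) _ _ _
falling-compatible-rising _ _ s0000 (() , _) _
falling-compatible-rising _ _ s1000 (() , _) _
falling-compatible-rising _ _ s1100 (() , _) _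
falling-compatible-rising _ _ s1110 (() , _) _
falling-compatible-rising _ _ s1111 (_ , ()) _

falling-blockwise : ∀ {u v} → Allowed u → Falling u → Allowed v →
  CompatibleSticks v u → CompatibleSticks v (complement u) → v ≡ blocks u (x₁ v) (x₄ v)
falling-blockwise s1000 _ s0000 _ _ = refl
falling-blockwise s1000 _ s1000 _ _ = refl
falling-blockwise s1000 _ s1100 _ (() , _)
falling-blockwise s1000 _ s1110 _ (() , _)
falling-blockwise s1000 _ s1111 _ _ = refl
falling-blockwise s1000 _ s0111 _ _ = refl
falling-blockwise s1000 _ s0011 (_ , ()) _
falling-blockwise s1000 _ s0001 (_ , ()) _
falling-blockwise s1100 _ s0000 _ _ = refl
falling-blockwise s1100 _ s1000 _ (_ , ())
falling-blockwise s1100 _ s1100 _ _ = refl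
falling-blockwise s1100 _ s1110 _ (() , _)
falling-blockwise s1100 _ s1111 _ _ = refl
falling-blockwise s1100 _ s0111 (() , _) _
falling-blockwise s1100 _ s0011 _ _ = refl
falling-blockwise s1100 _ s0001 (_ , ()) _
falling-blockwise s1110 _ s0000 _ _ = refl
falling-blockwise s1110 _ s1000 _ (_ , ())
falling-blockwise s1110 _ s1100 _ (_ , ())
falling-blockwise s1110 _ s1110 _ _ = refl
falling-blockwise s1110 _ s1111 _ _ = refl
falling-blockwise s1110 _ s0111 (() , _) _
falling-blockwise s1110 _ s0011 (() , _) _
falling-blockwise s1110 _ s0001 _ _ = refl
falling-blockwise s0000 (() , _) _ _ _
falling-blockwise s1111 (_ , ()) _ _ _
falling-blockwise s0111 (() , _) _ _ _
falling-blockwise s0011 (() , _) _ _ _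
falling-blockwise s0001 (() , _) _ _ _

falling-blocks-allowed : ∀ {u} → Allowed u → Falling u → ∀ p q → Allowed (blocks u p q)
falling-blocks-allowed s1000 _ true  true  = s1111
falling-blocks-allowed s1000 _ true  false = s1000
falling-blocks-allowed s1000 _ false true  = s0111
falling-blocks-allowed s1000 _ false false = s0000
falling-blocks-allowed s1100 _ true  true  = s1111
falling-blocks-allowed s1100 _ true  false = s1100
falling-blocks-allowed s1100 _ false true  = s0011
falling-blocks-allowed s1100 _ false false = s0000
falling-blocks-allowed s1110 _ true  true  = s1111
falling-blocks-allowed s1110 _ true  false = s1110
falling-blocks-allowed s1110 _ false true  = s0001
falling-blocks-allowed s1110 _ false false = s0000
falling-blocks-allowed s0000 (() , _)
falling-blocks-allowed s1111 (_ , ())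
falling-blocks-allowed s0111 (() , _)
falling-blocks-allowed s0011 (() , _)
falling-blocks-allowed s0001 (() , _)

majˢ-blocks : ∀ {m} {s : Fin m → Stick} u → (∀ v → s v ≡ blocks u (x₁ (s v)) (x₄ (s v))) →
  majˢ s ≡ blocks u (maj (x₁ ∘ s)) (maj (x₄ ∘ s))
majˢ-blocks {s = s} u s-blocks =
  stick-cong refl (middle (cong x₂ ∘ s-blocks)) (middle (cong x₃ ∘ s-blocks)) refl
  where
  middle : ∀ {b f} → (∀ v → f v ≡ (if b then x₁ (s v) else x₄ (s v))) →
    maj f ≡ (if b then maj (x₁ ∘ s) else maj (x₄ ∘ s))
  middle {b} f≗ = trans (maj-cong f≗) (maj-if b (x₁ ∘ s) (x₄ ∘ s))

≤-everywhere? : ∀ {m} (f g : Fin m → Bool) → (∀ v → f v B.≤ g v) ⊎ ∃ λ v → ¬ (f v B.≤ g v)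
≤-everywhere? {m} f g with all? (λ v → f v ≤? g v)
... | yes f≤g = inj₁ f≤g
... | no f≰g = inj₂ (¬∀⟶∃¬ m (λ v → f v B.≤ g v) (λ v → f v ≤? g v) f≰g)

majˢ-allowed : ∀ {m} (s : Fin m → Stick) → (∀ v → Allowed (s v)) →
  (∀ v w → CompatibleSticks (s v) (s w)) → Allowed (majˢ s)
majˢ-allowed s allowed compatible
  with ≤-everywhere? (x₄ ∘ s) (x₁ ∘ s) | ≤-everywhere? (x₁ ∘ s) (x₄ ∘ s)
... | inj₁ no-rising | _ =
  descending⇒allowed (majˢ-descending (λ v → allowed⇒descending (allowed v) (no-rising v)))
... | inj₂ _ | inj₁ no-falling =
  ascending⇒allowed (majˢ-ascending (λ v → allowed⇒ascending (allowed v) (no-falling v)))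
... | inj₂ (w , w-rises) | inj₂ (u , u-falls) =
  subst Allowed (sym (majˢ-blocks (s u) s-blocks)) (falling-blocks-allowed (allowed u) u-falling _ _)
  where
  u-falling : Falling (s u)
  u-falling = ≰⇒falling {s u} u-falls
  w≡ū : s w ≡ complement (s u)
  w≡ū = falling-compatible-rising (allowed u) u-falling (allowed w) (≰⇒rising {s w} w-rises) (compatible u w)
  s-blocks : ∀ v → s v ≡ blocks (s u) (x₁ (s v)) (x₄ (s v))
  s-blocks v = falling-blockwise (allowed u) u-falling (allowed v) (compatible v u)
                 (subst (CompatibleSticks (s v)) w≡ū (compatible v w))

pairwiseCompatible⇒condorcet : ∀ {n} {D : SuperDomain n} →
  IsSuperDomain D → PairwiseCompatible D → IsCondorcet D
pairwiseCompatible⇒condorcet tilings compatible _ _ Ts Ts∈D i j k l i<j j<k k<l =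
  majˢ-allowed (λ v → stickAt (Ts v) i j k l i<j j<k k<l)
    (λ v → tilings (Ts v) (Ts∈D v) i j k l i<j j<k k<l)
    (λ v w → let (∩-tiling , ∪-tiling) = compatible (Ts v) (Ts w) (Ts∈D v) (Ts∈D w)
             in ∩-tiling i j k l i<j j<k k<l , ∪-tiling i j k l i<j j<k k<l)

condorcet⇒majority-of-three : ∀ {n} {D : SuperDomain n} → IsCondorcet D →
  ∀ T T' U → D T → D T' → D U → IsTiling (sm (T ∷ T' ∷ U ∷ []))
condorcet⇒majority-of-three condorcet T T' U T∈D T'∈D U∈D =
  condorcet 3 (1 , refl) (T ∷ T' ∷ U ∷ []) λ { fzero → T∈D ; (fsuc fzero) → T'∈D ; (fsuc (fsuc fzero)) → U∈D }

normalCondorcet⇒pairwiseCompatible : ∀ {n} {D : SuperDomain n} →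
  IsNormal D → IsCondorcet D → PairwiseCompatible D
normalCondorcet⇒pairwiseCompatible (∅∈D , Λ∈D) condorcet T T' T∈D T'∈D =
  IsTiling-resp (λ t → maj-∧ (T t) (T' t)) (condorcet⇒majority-of-three condorcet T T' ∅T T∈D T'∈D ∅∈D) ,
  IsTiling-resp (λ t → maj-∨ (T t) (T' t)) (condorcet⇒majority-of-three condorcet T T' ΛT T∈D T'∈D Λ∈D)

proposition2 : (n : ℕ) → 2 ≤ n → (D : SuperDomain n) →
    IsSuperDomain D → IsNormal D →
    (PairwiseCompatible D → IsCondorcet D) × (IsCondorcet D → PairwiseCompatible D)
proposition2 _ _ _ tilings normal =
  pairwiseCompatible⇒condorcet tilings , normalCondorcet⇒pairwiseCompatible normal
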